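{- Let $A$ be a pseudo-BCI algebra and let $d:A\to A$ be a type I or a type II symmetric derivation on $A$. Then $d$ is regular (i.e. $d(1)=1$) if and only if every deductive system $D$ of $A$ satisfies $d(D)\subseteq D$.
   Context: A pseudo-BCI algebra is a structure $(A,\to,\rightsquigarrow,1)$ of type $(2,2,0)$ such that for all $x,y,z\in A$: $(x\to y)\rightsquigarrow[(y\to z)\rightsquigarrow(x\to z)]=1$; $(x\rightsquigarrow y)\to[(y\rightsquigarrow z)\to(x\rightsquigarrow z)]=1$; $1\to x=x$; $1\rightsquigarrow x=x$; and $x\to y=1$, $y\to x=1$ imply $x=y$. Put $x\Cup_1 y=(x\to y)\rightsquigarrow y$ and $x\Cup_2 y=(x\rightsquigarrow y)\to y$. A map $d:A\to A$ is a type I symmetric derivation if $d(x\to y)=(x\to d(y))\Cup_2(y\to d(x))$ and $d(x\rightsquigarrow y)=(x\rightsquigarrow d(y))\Cup_1(y\rightsquigarrow d(x))$ for all $x,y$; it is a type II symmetric derivation if $d(x\to y)=(d(x)\to y)\Cup_2(d(y)\to x)$ and $d(x\rightsquigarrow y)=(d(x)\rightsquigarrow y)\Cup_1(d(y)\rightsquigarrow x)$ for all $x,y$. A deductive system of $A$ is a subset $D\subseteq A$ with $1\in D$ such that $x\in D$ and $x\to y\in D$ imply $y\in D$. -}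

module Defs where

open import Level using (Level; suc; _⊔_)
open import Relation.Binary.PropositionalEquality using (_≡_)
open import Data.Product using (_×_)
open import Data.Sum using (_⊎_)

record PseudoBCI (a : Level) : Set (suc a) where
  infixr 25 _⇒_ _⇝_
  field
    Carrier : Set a
    _⇒_     : Carrier → Carrier → Carrier
    _⇝_     : Carrier → Carrier → Carrier
    one     : Carrier
    ax1     : ∀ x y z → ((x ⇒ y) ⇝ ((y ⇒ z) ⇝ (x ⇒ z))) ≡ one
    ax2     : ∀ x y z → ((x ⇝ y) ⇒ ((y ⇝ z) ⇒ (x ⇝ z))) ≡ one
    ax3     : ∀ x → (one ⇒ x) ≡ x
    ax4     : ∀ x → (one ⇝ x) ≡ x
    ax5     : ∀ x y → (x ⇒ y) ≡ one → (y ⇒ x) ≡ one → x ≡ y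

  _⋓₁_ : Carrier → Carrier → Carrier
  x ⋓₁ y = (x ⇒ y) ⇝ y

  _⋓₂_ : Carrier → Carrier → Carrier
  x ⋓₂ y = (x ⇝ y) ⇒ y

module _ {a : Level} (A : PseudoBCI a) where
  open PseudoBCI A

  IsTypeISymDerivation : (Carrier → Carrier) → Set a
  IsTypeISymDerivation d =
    (∀ x y → d (x ⇒ y) ≡ ((x ⇒ d y) ⋓₂ (y ⇒ d x))) ×
    (∀ x y → d (x ⇝ y) ≡ ((x ⇝ d y) ⋓₁ (y ⇝ d x)))

  IsTypeIISymDerivation : (Carrier → Carrier) → Set a
  IsTypeIISymDerivation d =
    (∀ x y → d (x ⇒ y) ≡ ((d x ⇒ y) ⋓₂ (d y ⇒ x))) ×
    (∀ x y → d (x ⇝ y) ≡ ((d x ⇝ y) ⋓₁ (d y ⇝ x)))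

  IsRegular : (Carrier → Carrier) → Set a
  IsRegular d = d one ≡ one

  record IsDeductiveSystem {ℓ : Level} (D : Carrier → Set ℓ) : Set (a ⊔ ℓ) where
    field
      contains-one : D one
      mp           : ∀ {x y} → D x → D (x ⇒ y) → D y

  ImageIncluded : {ℓ : Level} → (Carrier → Carrier) → (Carrier → Set ℓ) → Set (a ⊔ ℓ)
  ImageIncluded d D = ∀ x → D x → D (d x)

-- A type I derivation satisfies d(1) = d(x → x) = x → d(x), and for a type II derivation
-- d(x) = d(1 → x) = (d(1) → x) ⋓₂ (d(x) → 1). So if d is regular then in both cases
-- x → d(x) = 1 (for type II because x → (x ⋓₂ u) = 1), and a deductive system, being closed
-- under modus ponens, contains d(x) whenever it contains x. Conversely {1} is itself a
-- deductive system, so d(1) ∈ {1}.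
module Submission where

open import Defs
open import Level using (Level)
open import Data.Sum using (_⊎_; inj₁; inj₂)
open import Data.Product using (_×_; _,_)
open import Relation.Binary.PropositionalEquality
open ≡-Reasoning

module _ {a : Level} (A : PseudoBCI a) where
  open PseudoBCI A

  ⇒-refl : ∀ x → (x ⇒ x) ≡ one
  ⇒-refl x = begin
    x ⇒ x                                   ≡⟨ sym (ax3 _) ⟩
    one ⇒ (x ⇒ x)                           ≡⟨ cong₂ (λ u v → u ⇒ (v ⇒ v)) (sym (ax4 one)) (sym (ax4 x)) ⟩
    (one ⇝ one) ⇒ ((one ⇝ x) ⇒ (one ⇝ x))   ≡⟨ ax2 one one x ⟩
    one                                     ∎

  ⇝-refl : ∀ x → (x ⇝ x) ≡ one
  ⇝-refl x = begin
    x ⇝ x                                   ≡⟨ sym (ax4 _) ⟩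
    one ⇝ (x ⇝ x)                           ≡⟨ cong₂ (λ u v → u ⇝ (v ⇝ v)) (sym (ax3 one)) (sym (ax3 x)) ⟩
    (one ⇒ one) ⇝ ((one ⇒ x) ⇝ (one ⇒ x))   ≡⟨ ax1 one one x ⟩
    one                                     ∎

  ⋓₂-idem : ∀ x → (x ⋓₂ x) ≡ x
  ⋓₂-idem x = trans (cong (_⇒ x) (⇝-refl x)) (ax3 x)

  x⇒x⋓₂y≡one : ∀ x y → (x ⇒ (x ⋓₂ y)) ≡ one
  x⇒x⋓₂y≡one x y = begin
    x ⇒ ((x ⇝ y) ⇒ y)                       ≡⟨ cong₂ (λ u v → u ⇒ ((x ⇝ y) ⇒ v)) (sym (ax4 x)) (sym (ax4 y)) ⟩
    (one ⇝ x) ⇒ ((x ⇝ y) ⇒ (one ⇝ y))       ≡⟨ ax2 one x y ⟩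
    one                                     ∎

  typeI-d-one : ∀ {d} → IsTypeISymDerivation A d → ∀ x → d one ≡ (x ⇒ d x)
  typeI-d-one {d} (d⇒ , _) x = begin
    d one                      ≡⟨ cong d (sym (⇒-refl x)) ⟩
    d (x ⇒ x)                  ≡⟨ d⇒ x x ⟩
    (x ⇒ d x) ⋓₂ (x ⇒ d x)     ≡⟨ ⋓₂-idem (x ⇒ d x) ⟩
    x ⇒ d x                    ∎

  typeII-d : ∀ {d} → IsTypeIISymDerivation A d → ∀ x → d x ≡ ((d one ⇒ x) ⋓₂ (d x ⇒ one))
  typeII-d {d} (d⇒ , _) x = trans (cong d (sym (ax3 x))) (d⇒ one x)

  regular⇒x⇒dx≡one : ∀ {d} → IsTypeISymDerivation A d ⊎ IsTypeIISymDerivation A d →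
                     IsRegular A d → ∀ x → (x ⇒ d x) ≡ one
  regular⇒x⇒dx≡one (inj₁ typeI) d1≡1 x = trans (sym (typeI-d-one typeI x)) d1≡1
  regular⇒x⇒dx≡one {d} (inj₂ typeII) d1≡1 x = begin
    x ⇒ d x                               ≡⟨ cong (x ⇒_) (typeII-d typeII x) ⟩
    x ⇒ ((d one ⇒ x) ⋓₂ (d x ⇒ one))      ≡⟨ cong (λ u → x ⇒ ((u ⇒ x) ⋓₂ (d x ⇒ one))) d1≡1 ⟩
    x ⇒ ((one ⇒ x) ⋓₂ (d x ⇒ one))        ≡⟨ cong (λ u → x ⇒ (u ⋓₂ (d x ⇒ one))) (ax3 x) ⟩
    x ⇒ (x ⋓₂ (d x ⇒ one))                ≡⟨ x⇒x⋓₂y≡one x (d x ⇒ one) ⟩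
    one                                   ∎

  module _ {ℓ} {D : Carrier → Set ℓ} (ds : IsDeductiveSystem A D) where
    open IsDeductiveSystem ds

    upward-closed : ∀ {x y} → D x → (x ⇒ y) ≡ one → D y
    upward-closed Dx x⇒y≡1 = mp Dx (subst D (sym x⇒y≡1) contains-one)

  ≡one-isDeductiveSystem : IsDeductiveSystem A (_≡ one)
  ≡one-isDeductiveSystem = record
    { contains-one = refl
    ; mp           = λ { refl 1⇒y≡1 → trans (sym (ax3 _)) 1⇒y≡1 }
    }

theorem5p15 : {a : Level} (A : PseudoBCI a) (d : PseudoBCI.Carrier A → PseudoBCI.Carrier A) →
    (IsTypeISymDerivation A d ⊎ IsTypeIISymDerivation A d) →
    (IsRegular A d → ∀ (D : PseudoBCI.Carrier A → Set a) → IsDeductiveSystem A D → ImageIncluded A d D)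
    × ((∀ (D : PseudoBCI.Carrier A → Set a) → IsDeductiveSystem A D → ImageIncluded A d D) → IsRegular A d)
theorem5p15 A d derivation =
    (λ regular D ds x Dx → upward-closed A ds Dx (regular⇒x⇒dx≡one A derivation regular x))
  , (λ preserves → preserves (_≡ one) (≡one-isDeductiveSystem A) one refl)
  where open PseudoBCI A using (one)
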